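{- Let $P$ be a finite bounded poset with $|P|>1$, $\omega$ an admissible map on $P$, and $j$ a nonnegative integer with $j<\omega(P)$. Let $\mathsf{b}_j:\mathfrak{A}_{\triangledown}(P)\to\mathfrak{A}_{\triangledown}(P)$ be the absolute $j$-blocker map w.r.t. $\omega$. (i) The composite $\mathsf{b}_j\circ\mathsf{b}_j$ is a closure operator on $\mathfrak{A}_{\triangledown}(P)$. (ii) The image $\mathsf{b}_j(\mathfrak{A}_{\triangledown}(P))$ is a self-dual lattice, and the restriction of $\mathsf{b}_j$ to it is an anti-automorphism of it; consequently $\mathsf{b}_j(\mathsf{b}_j(B))=B$ for every $B\in\mathsf{b}_j(\mathfrak{A}_{\triangledown}(P))$. Moreover, the lattice $\mathsf{b}_j(\mathfrak{A}_{\triangledown}(P))$ is a sub-meet-semilattice of $\mathfrak{A}_{\triangledown}(P)$. (iii) For every $B\in\mathsf{b}_j(\mathfrak{A}_{\triangledown}(P))$, the preimage $(\mathsf{b}_j)^{ -1}(B)$ is a convex sub-join-semilattice of $\mathfrak{A}_{\triangledown}(P)$ whose greatest element is $\mathsf{b}_j(B)$.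
   Context: $P$ is a finite poset with least element $\hat0_P$ and greatest element $\hat1_P$, $|P|>1$. For $A\subseteq P$, $\mathfrak I(A)=\{p: p\le a\text{ for some }a\in A\}$, $\mathfrak F(A)=\{p: p\ge a\text{ for some }a\in A\}$; $\min Q$, $\max Q$ denote minimal/maximal elements of $Q\subseteq P$. $\mathfrak{A}_{\vartriangle}(P)$: all antichains (including empty) ordered by $\mathfrak I(A')\subseteq\mathfrak I(A'')$, with meet $A'\wedge_{\vartriangle}A''=\max(\mathfrak I(A')\cap\mathfrak I(A''))$. $\mathfrak{A}_{\triangledown}(P)$: all antichains ordered by $A'\le A''$ iff $\mathfrak F(A')\subseteq\mathfrak F(A'')$; it is a distributive lattice with meet $\min(\mathfrak F(A')\cap\mathfrak F(A''))$, join $\min(A'\cup A'')$, least element $\emptyset$ and greatest element $\{\hat0_P\}$ (the trivial antichains). Admissible map: $\omega:\mathfrak{A}_{\vartriangle}(P)\to\{ -1\}\cup\mathbb N$ with $\omega(\emptyset)=-1$, $\omega(\{\hat0_P\})=0$, $0<\omega(A')\le\omega(A'')$ whenever $\{\hat0_P\}<A'\le A''$ in $\mathfrak{A}_{\vartriangle}(P)$; $\omega(b):=\omega(\{b\})$, $\omega(P):=\omega(\{\hat1_P\})$. Absolute $j$-blocker: for a nontrivial antichain $A$, $\mathsf{b}_j(A)=\min\{b\in P: \omega(\{b\}\wedge_{\vartriangle}\{a\})>j\ \forall a\in A\}$; for the trivial antichains, $\mathsf{b}_j(\emptyset)=\{\hat0_P\}$ and $\mathsf{b}_j(\{\hat0_P\})=\emptyset$.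 A closure operator on a poset is an order-preserving, extensive, idempotent self-map. -}

module Defs where

import Level
open import Data.Nat using (ℕ; _<_)
open import Data.Bool using (Bool)
import Data.Bool.Properties as BoolP
open import Data.Fin using (Fin)
open import Data.Fin.Properties using (all?; any?) renaming (_≟_ to _≟F_)
open import Data.Fin.Subset using (Subset; _∈_; _∩_; _∪_; _⊆_; ⁅_⁆) renaming (⊥ to ∅)
open import Data.Fin.Subset.Properties using (_∈?_)
open import Data.Vec using (tabulate)
import Data.Vec.Properties as VecP
open import Data.Integer using (ℤ; +_; -[1+_]) renaming (_<_ to _<ℤ_; _≤_ to _≤ℤ_)
open import Data.Integer.Properties using () renaming (_<?_ to _<ℤ?_)
open import Data.Product using (Σ; ∃; _×_; _,_)
open import Data.Product.Relation.Binary.Pointwise.NonDependent using ()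
open import Relation.Nullary using (Dec; yes; no; ¬_; does)
open import Relation.Nullary.Decidable using (_×-dec_; _→-dec_)
open import Relation.Unary using (Pred)
open import Relation.Binary using (Rel; Decidable; IsDecPartialOrder)
open import Relation.Binary.PropositionalEquality using (_≡_; _≢_)
open import Function.Bundles using (_⇔_)

record FinBoundedPoset : Set₁ where
  field
    n    : ℕ
    _≼_  : Rel (Fin n) Level.zero
    isDecPartialOrder : IsDecPartialOrder _≡_ _≼_
    ⊥P   : Fin n
    ⊤P   : Fin n
    ⊥P-least    : ∀ x → ⊥P ≼ x
    ⊤P-greatest : ∀ x → x ≼ ⊤P
    card>1 : 1 < n

module _ (P : FinBoundedPoset) where
  open FinBoundedPoset P
  open IsDecPartialOrder isDecPartialOrder using () renaming (_≤?_ to _≼?_)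

  fromDec : {Q : Pred (Fin n) Level.zero} → (∀ x → Dec (Q x)) → Subset n
  fromDec Q? = tabulate (λ x → does (Q? x))

  _≟S_ : (A B : Subset n) → Dec (A ≡ B)
  _≟S_ = VecP.≡-dec BoolP._≟_

  IsAntichain : Subset n → Set
  IsAntichain A = ∀ x y → x ∈ A → y ∈ A → x ≼ y → x ≡ y

  Ideal : Subset n → Subset n
  Ideal A = fromDec (λ p → any? (λ a → (a ∈? A) ×-dec (p ≼? a)))

  Filter : Subset n → Subset n
  Filter A = fromDec (λ p → any? (λ a → (a ∈? A) ×-dec (a ≼? p)))

  maxS : Subset n → Subset n
  maxS Q = fromDec (λ x → (x ∈? Q) ×-dec all? (λ y → (y ∈? Q) →-dec ((x ≼? y) →-dec (y ≟F x))))

  minS : Subset n → Subset n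
  minS Q = fromDec (λ x → (x ∈? Q) ×-dec all? (λ y → (y ∈? Q) →-dec ((y ≼? x) →-dec (y ≟F x))))

  _≤△_ : Subset n → Subset n → Set
  A ≤△ B = Ideal A ⊆ Ideal B

  _∧△_ : Subset n → Subset n → Subset n
  A ∧△ B = maxS (Ideal A ∩ Ideal B)

  _≤▽_ : Subset n → Subset n → Set
  A ≤▽ B = Filter A ⊆ Filter B

  _∧▽_ : Subset n → Subset n → Subset n
  A ∧▽ B = minS (Filter A ∩ Filter B)

  _∨▽_ : Subset n → Subset n → Subset n
  A ∨▽ B = minS (A ∪ B)

  -- admissible maps ω : 𝔄_△(P) → {-1} ∪ ℕ (values taken in ℤ; only the
  -- values on antichains matter)
  record Admissible (ω : Subset n → ℤ) : Set where
    field
      ω-∅   : ω ∅ ≡ -[1+ 0 ]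
      ω-⊥   : ω ⁅ ⊥P ⁆ ≡ + 0
      ω-mono : ∀ A B → IsAntichain A → IsAntichain B →
               ⁅ ⊥P ⁆ ≤△ A → A ≢ ⁅ ⊥P ⁆ → A ≤△ B →
               (+ 0 <ℤ ω A) × (ω A ≤ℤ ω B)

  ωP : (Subset n → ℤ) → ℤ
  ωP ω = ω ⁅ ⊤P ⁆

  blocker : (Subset n → ℤ) → ℕ → Subset n → Subset n
  blocker ω j A with A ≟S ∅
  ... | yes _ = ⁅ ⊥P ⁆
  ... | no _ with A ≟S ⁅ ⊥P ⁆
  ...   | yes _ = ∅
  ...   | no _ = minS (fromDec (λ b → all? (λ a → (a ∈? A) →-dec ((+ j) <ℤ? ω (⁅ b ⁆ ∧△ ⁅ a ⁆)))))

  IsClosureOp▽ : (Subset n → Subset n) → Set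
  IsClosureOp▽ f =
    (∀ A → IsAntichain A → IsAntichain (f A)) ×
    (∀ A B → IsAntichain A → IsAntichain B → A ≤▽ B → f A ≤▽ f B) ×
    (∀ A → IsAntichain A → A ≤▽ f A) ×
    (∀ A → IsAntichain A → f (f A) ≡ f A)

  IsLatticeSub : (Subset n → Set) → Set
  IsLatticeSub S =
    ∀ B C → S B → S C →
      (∃ λ M → S M × M ≤▽ B × M ≤▽ C × (∀ D → S D → D ≤▽ B → D ≤▽ C → D ≤▽ M)) ×
      (∃ λ J → S J × B ≤▽ J × C ≤▽ J × (∀ D → S D → B ≤▽ D → C ≤▽ D → J ≤▽ D))

  IsAntiAutomorphism : (Subset n → Set) → (Subset n → Subset n) → Set
  IsAntiAutomorphism S f =
    (∀ B → S B → S (f B)) ×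
    (∀ B C → S B → S C → f B ≡ f C → B ≡ C) ×
    (∀ C → S C → ∃ λ B → S B × f B ≡ C) ×
    (∀ B C → S B → S C → (B ≤▽ C ⇔ f C ≤▽ f B))

  -- S is self-dual: isomorphic to its dual, i.e. admits an anti-automorphism
  IsSelfDual : (Subset n → Set) → Set
  IsSelfDual S = ∃ λ f → IsAntiAutomorphism S f

  IsSubMeetSemilattice▽ : (Subset n → Set) → Set
  IsSubMeetSemilattice▽ S = ∀ B C → S B → S C → S (B ∧▽ C)

  IsSubJoinSemilattice▽ : (Subset n → Set) → Set
  IsSubJoinSemilattice▽ S = ∀ B C → S B → S C → S (B ∨▽ C)

  IsConvex▽ : (Subset n → Set) → Set
  IsConvex▽ S = ∀ A B C → S A → IsAntichain B → S C → A ≤▽ B → B ≤▽ C → S B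

  IsGreatest▽ : (Subset n → Set) → Subset n → Set
  IsGreatest▽ S G = S G × (∀ A → S A → A ≤▽ G)

  Image : (Subset n → Subset n) → Subset n → Set
  Image f B = ∃ λ A → IsAntichain A × f A ≡ B

  Preimage : (Subset n → Subset n) → Subset n → Subset n → Set
  Preimage f B A = IsAntichain A × f A ≡ B

{-# OPTIONS --safe #-}
-- Write x ⋈ a when ω({x} ∧△ {a}) > j. By admissibility of ω this relation is
-- symmetric, upward closed in each argument, and never holds against ⊥P. The
-- filter of bⱼ(A) is the polar {x ∣ x ⋈ a for all a ∈ A} of A, the special values
-- on the trivial antichains included, so bⱼ is antitone and A ≤▽ bⱼ(bⱼ A): bⱼ is
-- a Galois connection of 𝔄▽(P) with itself. Since ≤▽ is antisymmetric on
-- antichains, everything else is the usual calculus of such connections,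
-- starting from bⱼ ∘ bⱼ ∘ bⱼ = bⱼ.
module Submission where

open import Defs
open import Data.Bool using (true)
open import Data.Empty using (⊥-elim)
open import Data.Fin using (Fin)
open import Data.Fin.Properties using (all?; any?) renaming (_≟_ to _≟F_)
open import Data.Fin.Subset using (Subset; _∈_; _∩_; _⊆_; ⁅_⁆) renaming (⊥ to ∅)
open import Data.Fin.Subset.Properties
  using (_∈?_; ⊆-reflexive; ⊆-trans; ⊆-antisym; x∈⁅x⁆; x∈⁅y⁆⇒x≡y; ∉⊥; ∩-comm; p∩q⊆p; p∩q⊆q; x∈p∩q⁺; p⊆p∪q; q⊆p∪q; x∈p∪q⁻)
open import Data.Integer using (ℤ; +_; +<+) renaming (_<_ to _<ℤ_)
open import Data.Integer.Properties using (<-≤-trans) renaming (_<?_ to _<ℤ?_)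
open import Data.List using (List; []; _∷_; allFin)
open import Data.List.Membership.Propositional.Properties using (∈-allFin)
open import Data.List.Relation.Unary.All using (All; []; _∷_) renaming (lookup to All-lookup)
open import Data.Nat using (ℕ)
open import Data.Product using (_×_; ∃; _,_; proj₁; proj₂)
open import Data.Sum using (inj₁; inj₂)
open import Data.Vec.Properties using (lookup∘tabulate; []=⇒lookup; lookup⇒[]=)
open import Function using (_∘_; flip)
open import Function.Bundles using (mk⇔)
open import Level using (0ℓ)
open import Relation.Binary using (Rel; Decidable; IsPartialOrder; IsDecPartialOrder)
import Relation.Binary.Construct.Flip.EqAndOrd as Flip
open import Relation.Binary.PropositionalEquality
  using (_≡_; refl; sym; trans; cong; subst; subst₂; module ≡-Reasoning)
open import Relation.Nullary using (Dec; does; yes; no; ¬_)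
open import Relation.Nullary.Decidable using (_×-dec_; _→-dec_; dec-true)
open import Relation.Unary using (Pred)

module MaximalElements {n : ℕ} {_≤_ : Rel (Fin n) 0ℓ}
  (isPartialOrder : IsPartialOrder _≡_ _≤_) (_≤?_ : Decidable _≤_) (Q : Subset n) where

  open IsPartialOrder isPartialOrder using (antisym) renaming (refl to ≤-refl; trans to ≤-trans)

  MaximalAmong : List (Fin n) → Fin n → Set
  MaximalAmong ys m = All (λ y → y ∈ Q → m ≤ y → y ≡ m) ys

  -- Whenever the next candidate y lies above the current bound, restart from y.
  maximalAmong-above : ∀ ys {x} → x ∈ Q → ∃ λ m → m ∈ Q × x ≤ m × MaximalAmong ys m
  maximalAmong-above [] {x} x∈Q = x , x∈Q , ≤-refl , []
  maximalAmong-above (y ∷ ys) x∈Q with maximalAmong-above ys x∈Q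
  ... | m , m∈Q , x≤m , max with (y ∈? Q) ×-dec (m ≤? y)
  ...   | no ¬y∈Q×m≤y = m , m∈Q , x≤m , (λ y∈Q m≤y → ⊥-elim (¬y∈Q×m≤y (y∈Q , m≤y))) ∷ max
  ...   | yes (y∈Q , m≤y) with maximalAmong-above ys y∈Q
  ...     | m′ , m′∈Q , y≤m′ , max′ =
    m′ , m′∈Q , ≤-trans x≤m (≤-trans m≤y y≤m′) , (λ _ m′≤y → antisym y≤m′ m′≤y) ∷ max′

  maximal-above : ∀ {x} → x ∈ Q → ∃ λ m → m ∈ Q × x ≤ m × (∀ y → y ∈ Q → m ≤ y → y ≡ m)
  maximal-above x∈Q with maximalAmong-above (allFin n) x∈Q
  ... | m , m∈Q , x≤m , max = m , m∈Q , x≤m , λ y → All-lookup max (∈-allFin y)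

module _ (P : FinBoundedPoset) where
  open FinBoundedPoset P
  open IsDecPartialOrder isDecPartialOrder
    using (isPartialOrder) renaming (_≤?_ to _≼?_; refl to ≼-refl; trans to ≼-trans; antisym to ≼-antisym)

  ∈-fromDec⁻ : {Q : Pred (Fin n) 0ℓ} (Q? : ∀ x → Dec (Q x)) {x : Fin n} → x ∈ fromDec P Q? → Q x
  ∈-fromDec⁻ {Q} Q? {x} x∈ = witness (Q? x) (trans (sym (lookup∘tabulate _ x)) ([]=⇒lookup x∈))
    where
    witness : (q? : Dec (Q x)) → does q? ≡ true → Q x
    witness (yes q) _ = q

  ∈-fromDec⁺ : {Q : Pred (Fin n) 0ℓ} (Q? : ∀ x → Dec (Q x)) {x : Fin n} → Q x → x ∈ fromDec P Q?
  ∈-fromDec⁺ Q? {x} q = lookup⇒[]= x _ (trans (lookup∘tabulate _ x) (dec-true (Q? x) q))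

  ∈-Filter⁻ : ∀ {A x} → x ∈ Filter P A → ∃ λ a → a ∈ A × a ≼ x
  ∈-Filter⁻ {A} = ∈-fromDec⁻ (λ p → any? (λ a → (a ∈? A) ×-dec (a ≼? p)))

  ∈-Filter⁺ : ∀ {A x a} → a ∈ A → a ≼ x → x ∈ Filter P A
  ∈-Filter⁺ {A} a∈A a≼x = ∈-fromDec⁺ (λ p → any? (λ a → (a ∈? A) ×-dec (a ≼? p))) (_ , a∈A , a≼x)

  ∈-Ideal⁻ : ∀ {A x} → x ∈ Ideal P A → ∃ λ a → a ∈ A × x ≼ a
  ∈-Ideal⁻ {A} = ∈-fromDec⁻ (λ p → any? (λ a → (a ∈? A) ×-dec (p ≼? a)))

  ∈-Ideal⁺ : ∀ {A x a} → a ∈ A → x ≼ a → x ∈ Ideal P A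
  ∈-Ideal⁺ {A} a∈A x≼a = ∈-fromDec⁺ (λ p → any? (λ a → (a ∈? A) ×-dec (p ≼? a))) (_ , a∈A , x≼a)

  ∈-maxS⁻ : ∀ {Q x} → x ∈ maxS P Q → x ∈ Q × (∀ y → y ∈ Q → x ≼ y → y ≡ x)
  ∈-maxS⁻ {Q} = ∈-fromDec⁻ (λ x → (x ∈? Q) ×-dec all? (λ y → (y ∈? Q) →-dec ((x ≼? y) →-dec (y ≟F x))))

  ∈-maxS⁺ : ∀ {Q x} → x ∈ Q → (∀ y → y ∈ Q → x ≼ y → y ≡ x) → x ∈ maxS P Q
  ∈-maxS⁺ {Q} x∈Q max =
    ∈-fromDec⁺ (λ x → (x ∈? Q) ×-dec all? (λ y → (y ∈? Q) →-dec ((x ≼? y) →-dec (y ≟F x)))) (x∈Q , max)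

  ∈-minS⁻ : ∀ {Q x} → x ∈ minS P Q → x ∈ Q × (∀ y → y ∈ Q → y ≼ x → y ≡ x)
  ∈-minS⁻ {Q} = ∈-fromDec⁻ (λ x → (x ∈? Q) ×-dec all? (λ y → (y ∈? Q) →-dec ((y ≼? x) →-dec (y ≟F x))))

  ∈-minS⁺ : ∀ {Q x} → x ∈ Q → (∀ y → y ∈ Q → y ≼ x → y ≡ x) → x ∈ minS P Q
  ∈-minS⁺ {Q} x∈Q min =
    ∈-fromDec⁺ (λ x → (x ∈? Q) ×-dec all? (λ y → (y ∈? Q) →-dec ((y ≼? x) →-dec (y ≟F x)))) (x∈Q , min)

  maxS-above : ∀ {Q x} → x ∈ Q → ∃ λ m → m ∈ maxS P Q × x ≼ m
  maxS-above {Q} x∈Q with MaximalElements.maximal-above isPartialOrder _≼?_ Q x∈Q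
  ... | m , m∈Q , x≼m , max = m , ∈-maxS⁺ m∈Q max , x≼m

  minS-below : ∀ {Q x} → x ∈ Q → ∃ λ m → m ∈ minS P Q × m ≼ x
  minS-below {Q} x∈Q with MaximalElements.maximal-above (Flip.isPartialOrder isPartialOrder) (flip _≼?_) Q x∈Q
  ... | m , m∈Q , m≼x , min = m , ∈-minS⁺ m∈Q min , m≼x

  maxS-antichain : ∀ Q → IsAntichain P (maxS P Q)
  maxS-antichain Q x y x∈ y∈ x≼y = sym (proj₂ (∈-maxS⁻ x∈) y (proj₁ (∈-maxS⁻ y∈)) x≼y)

  minS-antichain : ∀ Q → IsAntichain P (minS P Q)
  minS-antichain Q x y x∈ y∈ x≼y = proj₂ (∈-minS⁻ y∈) x (proj₁ (∈-minS⁻ x∈)) x≼y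

  ⁅⁆-antichain : ∀ z → IsAntichain P ⁅ z ⁆
  ⁅⁆-antichain z x y x∈ y∈ _ = trans (x∈⁅y⁆⇒x≡y z x∈) (sym (x∈⁅y⁆⇒x≡y z y∈))

  ∅-antichain : IsAntichain P ∅
  ∅-antichain x y x∈ _ _ = ⊥-elim (∉⊥ x∈)

  ⊆-Filter : ∀ {A} → A ⊆ Filter P A
  ⊆-Filter a∈A = ∈-Filter⁺ a∈A ≼-refl

  Filter-upward : ∀ {A x y} → x ∈ Filter P A → x ≼ y → y ∈ Filter P A
  Filter-upward x∈ x≼y with ∈-Filter⁻ x∈
  ... | a , a∈A , a≼x = ∈-Filter⁺ a∈A (≼-trans a≼x x≼y)

  Filter-mono : ∀ {A B} → A ⊆ B → Filter P A ⊆ Filter P B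
  Filter-mono A⊆B x∈ with ∈-Filter⁻ x∈
  ... | a , a∈A , a≼x = ∈-Filter⁺ (A⊆B a∈A) a≼x

  Filter-idem : ∀ {A} → Filter P (Filter P A) ⊆ Filter P A
  Filter-idem x∈ with ∈-Filter⁻ x∈
  ... | y , y∈ , y≼x = Filter-upward y∈ y≼x

  Filter-minS⁻ : ∀ {Q} → Filter P (minS P Q) ⊆ Filter P Q
  Filter-minS⁻ = Filter-mono (proj₁ ∘ ∈-minS⁻)

  Filter-minS⁺ : ∀ {Q} → Filter P Q ⊆ Filter P (minS P Q)
  Filter-minS⁺ x∈ with ∈-Filter⁻ x∈
  ... | q , q∈Q , q≼x with minS-below q∈Q
  ...   | m , m∈ , m≼q = ∈-Filter⁺ m∈ (≼-trans m≼q q≼x)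

  Ideal-downward : ∀ {A x y} → y ∈ Ideal P A → x ≼ y → x ∈ Ideal P A
  Ideal-downward y∈ x≼y with ∈-Ideal⁻ y∈
  ... | a , a∈A , y≼a = ∈-Ideal⁺ a∈A (≼-trans x≼y y≼a)

  ⊆-Ideal-maxS : ∀ {Q} → Q ⊆ Ideal P (maxS P Q)
  ⊆-Ideal-maxS x∈Q with maxS-above x∈Q
  ... | m , m∈ , x≼m = ∈-Ideal⁺ m∈ x≼m

  ∈-Ideal-⁅⁆⁻ : ∀ {x y} → y ∈ Ideal P ⁅ x ⁆ → y ≼ x
  ∈-Ideal-⁅⁆⁻ {x} y∈ with ∈-Ideal⁻ y∈
  ... | a , a∈ , y≼a = subst (_ ≼_) (x∈⁅y⁆⇒x≡y x a∈) y≼a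

  ∈-Ideal-⁅⁆⁺ : ∀ {x y} → y ≼ x → y ∈ Ideal P ⁅ x ⁆
  ∈-Ideal-⁅⁆⁺ {x} = ∈-Ideal⁺ (x∈⁅x⁆ x)

  ⁅⁆-≤△-maxS : ∀ {Q x} → x ∈ Q → _≤△_ P ⁅ x ⁆ (maxS P Q)
  ⁅⁆-≤△-maxS x∈Q y∈ = Ideal-downward (⊆-Ideal-maxS x∈Q) (∈-Ideal-⁅⁆⁻ y∈)

  maxS-mono-≤△ : ∀ {Q Q′} → Q ⊆ Q′ → _≤△_ P (maxS P Q) (maxS P Q′)
  maxS-mono-≤△ Q⊆Q′ y∈ with ∈-Ideal⁻ y∈
  ... | m , m∈ , y≼m = Ideal-downward (⊆-Ideal-maxS (Q⊆Q′ (proj₁ (∈-maxS⁻ m∈)))) y≼m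

  maxS-greatest : ∀ {Q x} → x ∈ Q → (∀ {y} → y ∈ Q → y ≼ x) → maxS P Q ≡ ⁅ x ⁆
  maxS-greatest {Q} {x} x∈Q greatest = ⊆-antisym maxS⊆⁅x⁆ ⁅x⁆⊆maxS
    where
    maxS⊆⁅x⁆ : maxS P Q ⊆ ⁅ x ⁆
    maxS⊆⁅x⁆ {y} y∈ with ∈-maxS⁻ y∈
    ... | y∈Q , max = subst (_∈ ⁅ x ⁆) (max x x∈Q (greatest y∈Q)) (x∈⁅x⁆ x)
    ⁅x⁆⊆maxS : ⁅ x ⁆ ⊆ maxS P Q
    ⁅x⁆⊆maxS y∈ with x∈⁅y⁆⇒x≡y x y∈
    ... | refl = ∈-maxS⁺ x∈Q (λ z z∈Q x≼z → ≼-antisym (greatest z∈Q) x≼z)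

  infix 4 _⊑_
  _⊑_ : Rel (Subset n) 0ℓ
  _⊑_ = _≤▽_ P

  antichain-⊆ : ∀ {A B} → IsAntichain P A → A ⊑ B → B ⊑ A → A ⊆ B
  antichain-⊆ {A} {B} acA A⊑B B⊑A {x} x∈A with ∈-Filter⁻ (A⊑B (⊆-Filter x∈A))
  ... | b , b∈B , b≼x with ∈-Filter⁻ (B⊑A (⊆-Filter b∈B))
  ...   | a , a∈A , a≼b with acA a x a∈A x∈A (≼-trans a≼b b≼x)
  ...     | refl = subst (_∈ B) (≼-antisym b≼x a≼b) b∈B

  ⊑-antisym : ∀ {A B} → IsAntichain P A → IsAntichain P B → A ⊑ B → B ⊑ A → A ≡ B
  ⊑-antisym acA acB A⊑B B⊑A = ⊆-antisym (antichain-⊆ acA A⊑B B⊑A) (antichain-⊆ acB B⊑A A⊑B)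

  ∨▽-upperˡ : ∀ A B → A ⊑ _∨▽_ P A B
  ∨▽-upperˡ A B = Filter-minS⁺ ∘ Filter-mono (p⊆p∪q B)

  ∨▽-upperʳ : ∀ A B → B ⊑ _∨▽_ P A B
  ∨▽-upperʳ A B = Filter-minS⁺ ∘ Filter-mono (q⊆p∪q A B)

  ∨▽-least : ∀ {A B D} → A ⊑ D → B ⊑ D → _∨▽_ P A B ⊑ D
  ∨▽-least {A} {B} A⊑D B⊑D x∈ with ∈-Filter⁻ (Filter-minS⁻ x∈)
  ... | c , c∈A∪B , c≼x with x∈p∪q⁻ A B c∈A∪B
  ...   | inj₁ c∈A = Filter-upward (A⊑D (⊆-Filter c∈A)) c≼x
  ...   | inj₂ c∈B = Filter-upward (B⊑D (⊆-Filter c∈B)) c≼x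

  ∧▽-lowerˡ : ∀ A B → _∧▽_ P A B ⊑ A
  ∧▽-lowerˡ A B = Filter-idem ∘ Filter-mono (p∩q⊆p _ _) ∘ Filter-minS⁻

  ∧▽-lowerʳ : ∀ A B → _∧▽_ P A B ⊑ B
  ∧▽-lowerʳ A B = Filter-idem ∘ Filter-mono (p∩q⊆q _ _) ∘ Filter-minS⁻

  ∧▽-greatest : ∀ {A B D} → D ⊑ A → D ⊑ B → D ⊑ _∧▽_ P A B
  ∧▽-greatest D⊑A D⊑B x∈ = Filter-minS⁺ (⊆-Filter (x∈p∩q⁺ (D⊑A x∈ , D⊑B x∈)))

  infixl 7 _⊓_
  _⊓_ : Fin n → Fin n → Subset n
  x ⊓ a = _∧△_ P ⁅ x ⁆ ⁅ a ⁆

  ⊓-comm : ∀ x a → x ⊓ a ≡ a ⊓ x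
  ⊓-comm x a = cong (maxS P) (∩-comm (Ideal P ⁅ x ⁆) (Ideal P ⁅ a ⁆))

  ⊥∈Ideal⁅x⁆∩Ideal⁅a⁆ : ∀ x a → ⊥P ∈ Ideal P ⁅ x ⁆ ∩ Ideal P ⁅ a ⁆
  ⊥∈Ideal⁅x⁆∩Ideal⁅a⁆ x a = x∈p∩q⁺ (∈-Ideal-⁅⁆⁺ (⊥P-least x) , ∈-Ideal-⁅⁆⁺ (⊥P-least a))

  ⊓-⊥ : ∀ x → x ⊓ ⊥P ≡ ⁅ ⊥P ⁆
  ⊓-⊥ x = maxS-greatest (⊥∈Ideal⁅x⁆∩Ideal⁅a⁆ x ⊥P) (∈-Ideal-⁅⁆⁻ ∘ p∩q⊆q _ _)

  ⁅⊥⁆-≤△-⊓ : ∀ x a → _≤△_ P ⁅ ⊥P ⁆ (x ⊓ a)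
  ⁅⊥⁆-≤△-⊓ x a = ⁅⁆-≤△-maxS (⊥∈Ideal⁅x⁆∩Ideal⁅a⁆ x a)

  ⊓-monoʳ-≤△ : ∀ x {a a′} → a ≼ a′ → _≤△_ P (x ⊓ a) (x ⊓ a′)
  ⊓-monoʳ-≤△ x {a} {a′} a≼a′ = maxS-mono-≤△ ↓x∩↓a⊆↓x∩↓a′
    where
    ↓x∩↓a⊆↓x∩↓a′ : Ideal P ⁅ x ⁆ ∩ Ideal P ⁅ a ⁆ ⊆ Ideal P ⁅ x ⁆ ∩ Ideal P ⁅ a′ ⁆
    ↓x∩↓a⊆↓x∩↓a′ y∈ = x∈p∩q⁺ (p∩q⊆p _ _ y∈ , ∈-Ideal-⁅⁆⁺ (≼-trans (∈-Ideal-⁅⁆⁻ (p∩q⊆q _ _ y∈)) a≼a′))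

  module Blocker {ω : Subset n → ℤ} (admissible : Admissible P ω) (j : ℕ) where
    open Admissible admissible using (ω-⊥; ω-mono)

    infix 4 _⋈_
    _⋈_ : Fin n → Fin n → Set
    x ⋈ a = + j <ℤ ω (x ⊓ a)

    ¬j<ω⁅⊥⁆ : ¬ (+ j <ℤ ω ⁅ ⊥P ⁆)
    ¬j<ω⁅⊥⁆ j<ω with subst (+ j <ℤ_) ω-⊥ j<ω
    ... | +<+ ()

    ¬⋈⊥ : ∀ x → ¬ (x ⋈ ⊥P)
    ¬⋈⊥ x = ¬j<ω⁅⊥⁆ ∘ subst (λ M → + j <ℤ ω M) (⊓-⊥ x)

    ⋈-sym : ∀ {x a} → x ⋈ a → a ⋈ x
    ⋈-sym {x} {a} = subst (λ M → + j <ℤ ω M) (⊓-comm x a)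

    ⋈-monoʳ : ∀ {x a a′} → a ≼ a′ → x ⋈ a → x ⋈ a′
    ⋈-monoʳ {x} {a} a≼a′ x⋈a with _≟S_ P (x ⊓ a) ⁅ ⊥P ⁆
    ... | yes x⊓a≡⁅⊥⁆ = ⊥-elim (¬j<ω⁅⊥⁆ (subst (λ M → + j <ℤ ω M) x⊓a≡⁅⊥⁆ x⋈a))
    ... | no x⊓a≢⁅⊥⁆ = <-≤-trans x⋈a (proj₂ (ω-mono _ _ (maxS-antichain _) (maxS-antichain _)
                                                   (⁅⊥⁆-≤△-⊓ x a) x⊓a≢⁅⊥⁆ (⊓-monoʳ-≤△ x a≼a′)))

    ⋈-monoˡ : ∀ {x x′ a} → x ≼ x′ → x ⋈ a → x′ ⋈ a
    ⋈-monoˡ x≼x′ = ⋈-sym ∘ ⋈-monoʳ x≼x′ ∘ ⋈-sym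

    Polar : Subset n → Fin n → Set
    Polar A x = ∀ a → a ∈ A → x ⋈ a

    polar? : ∀ A x → Dec (Polar A x)
    polar? A x = all? (λ a → (a ∈? A) →-dec (+ j <ℤ? ω (x ⊓ a)))

    Polar-Filter : ∀ {A x a} → Polar A x → a ∈ Filter P A → x ⋈ a
    Polar-Filter polar a∈ with ∈-Filter⁻ a∈
    ... | a′ , a′∈A , a′≼a = ⋈-monoʳ a′≼a (polar a′ a′∈A)

    bⱼ : Subset n → Subset n
    bⱼ = blocker P ω j

    Filter-bⱼ⁻ : ∀ A {x} → x ∈ Filter P (bⱼ A) → Polar A x
    Filter-bⱼ⁻ A x∈ with _≟S_ P A ∅
    ... | yes refl = λ a a∈∅ → ⊥-elim (∉⊥ a∈∅)
    ... | no _ with _≟S_ P A ⁅ ⊥P ⁆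
    ...   | yes refl = ⊥-elim (∉⊥ (proj₁ (proj₂ (∈-Filter⁻ x∈))))
    ...   | no _ with ∈-Filter⁻ x∈
    ...     | m , m∈ , m≼x = λ a a∈A → ⋈-monoˡ m≼x (∈-fromDec⁻ (polar? A) (proj₁ (∈-minS⁻ m∈)) a a∈A)

    Filter-bⱼ⁺ : ∀ A {x} → Polar A x → x ∈ Filter P (bⱼ A)
    Filter-bⱼ⁺ A {x} polar with _≟S_ P A ∅
    ... | yes refl = ∈-Filter⁺ (x∈⁅x⁆ ⊥P) (⊥P-least x)
    ... | no _ with _≟S_ P A ⁅ ⊥P ⁆
    ...   | yes refl = ⊥-elim (¬⋈⊥ x (polar ⊥P (x∈⁅x⁆ ⊥P)))
    ...   | no _ = Filter-minS⁺ (⊆-Filter (∈-fromDec⁺ (polar? A) polar))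

    bⱼ-antichain : ∀ A → IsAntichain P (bⱼ A)
    bⱼ-antichain A with _≟S_ P A ∅
    ... | yes _ = ⁅⁆-antichain ⊥P
    ... | no _ with _≟S_ P A ⁅ ⊥P ⁆
    ...   | yes _ = ∅-antichain
    ...   | no _ = minS-antichain _

    bⱼ-antitone : ∀ {A B} → A ⊑ B → bⱼ B ⊑ bⱼ A
    bⱼ-antitone {A} {B} A⊑B x∈ =
      Filter-bⱼ⁺ A (λ a a∈A → Polar-Filter (Filter-bⱼ⁻ B x∈) (A⊑B (⊆-Filter a∈A)))

    ⊑-bⱼ² : ∀ A → A ⊑ bⱼ (bⱼ A)
    ⊑-bⱼ² A x∈ = Filter-bⱼ⁺ (bⱼ A) (λ c c∈ → ⋈-sym (Polar-Filter (Filter-bⱼ⁻ A (⊆-Filter c∈)) x∈))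

    ⊑-bⱼ-swap : ∀ {A B} → A ⊑ bⱼ B → B ⊑ bⱼ A
    ⊑-bⱼ-swap {A} {B} A⊑bⱼB = ⊆-trans (⊑-bⱼ² B) (bⱼ-antitone A⊑bⱼB)

    bⱼ³ : ∀ A → bⱼ (bⱼ (bⱼ A)) ≡ bⱼ A
    bⱼ³ A = ⊑-antisym (bⱼ-antichain (bⱼ (bⱼ A))) (bⱼ-antichain A) (bⱼ-antitone (⊑-bⱼ² A)) (⊑-bⱼ² (bⱼ A))

    bⱼ²-isClosureOp : IsClosureOp▽ P (bⱼ ∘ bⱼ)
    bⱼ²-isClosureOp =
      (λ A _ → bⱼ-antichain (bⱼ A)) ,
      (λ _ _ _ _ → bⱼ-antitone ∘ bⱼ-antitone) ,
      (λ A _ → ⊑-bⱼ² A) ,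
      (λ A _ → bⱼ³ (bⱼ A))

    Closed : Subset n → Set
    Closed = Image P bⱼ

    closed-fixed : ∀ {B} → Closed B → bⱼ (bⱼ B) ≡ B
    closed-fixed (A , _ , refl) = bⱼ³ A

    bⱼ-closed : ∀ A → Closed (bⱼ A)
    bⱼ-closed A = bⱼ (bⱼ A) , bⱼ-antichain (bⱼ A) , bⱼ³ A

    closed-if-bⱼ²⊑ : ∀ {A} → IsAntichain P A → bⱼ (bⱼ A) ⊑ A → Closed A
    closed-if-bⱼ²⊑ {A} acA bⱼ²A⊑A =
      bⱼ A , bⱼ-antichain A , ⊑-antisym (bⱼ-antichain (bⱼ A)) acA bⱼ²A⊑A (⊑-bⱼ² A)

    bⱼ²-least : ∀ {A B} → A ⊑ B → Closed B → bⱼ (bⱼ A) ⊑ B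
    bⱼ²-least {A} A⊑B closedB = subst (bⱼ (bⱼ A) ⊑_) (closed-fixed closedB) (bⱼ-antitone (bⱼ-antitone A⊑B))

    closed-∧▽ : IsSubMeetSemilattice▽ P Closed
    closed-∧▽ B C closedB closedC = closed-if-bⱼ²⊑ (minS-antichain _)
      (∧▽-greatest (bⱼ²-least (∧▽-lowerˡ B C) closedB) (bⱼ²-least (∧▽-lowerʳ B C) closedC))

    closed-isLattice : IsLatticeSub P Closed
    closed-isLattice B C closedB closedC =
      (_∧▽_ P B C , closed-∧▽ B C closedB closedC , ∧▽-lowerˡ B C , ∧▽-lowerʳ B C , λ _ _ → ∧▽-greatest) ,
      (bⱼ (bⱼ U) , bⱼ-closed (bⱼ U) , ⊆-trans (∨▽-upperˡ B C) (⊑-bⱼ² U) , ⊆-trans (∨▽-upperʳ B C) (⊑-bⱼ² U) ,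
       λ D closedD B⊑D C⊑D → bⱼ²-least (∨▽-least B⊑D C⊑D) closedD)
      where
      U : Subset n
      U = _∨▽_ P B C

    closed-bⱼ-injective : ∀ {B C} → Closed B → Closed C → bⱼ B ≡ bⱼ C → B ≡ C
    closed-bⱼ-injective {B} {C} closedB closedC bⱼB≡bⱼC = begin
      B          ≡⟨ closed-fixed closedB ⟨
      bⱼ (bⱼ B)  ≡⟨ cong bⱼ bⱼB≡bⱼC ⟩
      bⱼ (bⱼ C)  ≡⟨ closed-fixed closedC ⟩
      C          ∎
      where open ≡-Reasoning

    bⱼ-isAntiAutomorphism : IsAntiAutomorphism P Closed bⱼ
    bⱼ-isAntiAutomorphism =
      (λ B _ → bⱼ-closed B) ,
      (λ _ _ → closed-bⱼ-injective) ,
      (λ C closedC → bⱼ C , bⱼ-closed C , closed-fixed closedC) ,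
      (λ B C closedB closedC → mk⇔ bⱼ-antitone
        (subst₂ _⊑_ (closed-fixed closedB) (closed-fixed closedC) ∘ bⱼ-antitone))

    preimage-convex : ∀ B → IsConvex▽ P (Preimage P bⱼ B)
    preimage-convex B A D C (_ , bⱼA≡B) acD (_ , bⱼC≡B) A⊑D D⊑C =
      acD , ⊑-antisym (bⱼ-antichain D) (subst (IsAntichain P) bⱼA≡B (bⱼ-antichain A))
              (subst (bⱼ D ⊑_) bⱼA≡B (bⱼ-antitone A⊑D))
              (subst (_⊑ bⱼ D) bⱼC≡B (bⱼ-antitone D⊑C))

    preimage-∨▽ : ∀ B → IsSubJoinSemilattice▽ P (Preimage P bⱼ B)
    preimage-∨▽ _ A C (_ , refl) (_ , bⱼC≡bⱼA) =
      minS-antichain _ ,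
      ⊑-antisym (bⱼ-antichain U) (bⱼ-antichain A)
        (bⱼ-antitone (∨▽-upperˡ A C))
        (⊑-bⱼ-swap (∨▽-least (⊑-bⱼ² A) (⊑-bⱼ-swap (⊆-reflexive (cong (Filter P) (sym bⱼC≡bⱼA))))))
      where
      U : Subset n
      U = _∨▽_ P A C

    preimage-greatest : ∀ {B} → Closed B → IsGreatest▽ P (Preimage P bⱼ B) (bⱼ B)
    preimage-greatest {B} closedB =
      (bⱼ-antichain B , closed-fixed closedB) ,
      λ A (_ , bⱼA≡B) → subst (λ Z → A ⊑ bⱼ Z) bⱼA≡B (⊑-bⱼ² A)

proposition3p1 : (P : FinBoundedPoset) (ω : Subset (FinBoundedPoset.n P) → ℤ) →
    Admissible P ω → (j : ℕ) → + j <ℤ ωP P ω →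
    -- (i)
    IsClosureOp▽ P (blocker P ω j ∘ blocker P ω j) ×
    -- (ii)
    (IsLatticeSub P (Image P (blocker P ω j)) ×
     IsSelfDual P (Image P (blocker P ω j)) ×
     IsAntiAutomorphism P (Image P (blocker P ω j)) (blocker P ω j) ×
     (∀ B → Image P (blocker P ω j) B → blocker P ω j (blocker P ω j B) ≡ B) ×
     IsSubMeetSemilattice▽ P (Image P (blocker P ω j))) ×
    -- (iii)
    (∀ B → Image P (blocker P ω j) B →
      IsConvex▽ P (Preimage P (blocker P ω j) B) ×
      IsSubJoinSemilattice▽ P (Preimage P (blocker P ω j) B) ×
      IsGreatest▽ P (Preimage P (blocker P ω j) B) (blocker P ω j B))
proposition3p1 P ω admissible j _ =
  bⱼ²-isClosureOp ,
  (closed-isLattice , (bⱼ , bⱼ-isAntiAutomorphism) , bⱼ-isAntiAutomorphism , (λ _ → closed-fixed) , closed-∧▽) ,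
  (λ B closedB → preimage-convex B , preimage-∨▽ B , preimage-greatest closedB)
  where open Blocker P admissible j
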